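{- Let $K_{a,b}$ be a complete bipartite graph with partite sets $A$ and $B$, $a=|A|$, $b=|B|$, and let $\langle \tau,\{D_i\}_{i\in[a+b]}\rangle$ be a storyplan of $K_{a,b}$. Then there exists a step $i\in[a+b]$ at which all vertices of $A$ are visible or all vertices of $B$ are visible.
   Context: For a graph $G=(V,E)$ with $n$ vertices, a storyplan is a pair $\langle \tau,\{D_i\}_{i\in[n]}\rangle$ where $\tau:V\to[n]$ is a bijection, a vertex $v$ is visible at step $i$ iff $\tau(v)\le i\le \max_{u\in N[v]}\tau(u)$ ($N[v]$ the closed neighborhood of $v$), each $D_i$ is a drawing of the subgraph induced by the vertices visible at step $i$, every $D_i$ is planar, each vertex is the same point in all frames containing it, and each edge the same curve in all frames containing it. -}

module Defs where

open import Data.Nat using (ℕ; _≤_)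
open import Data.Fin using (Fin; toℕ)
open import Data.Sum using (_⊎_; inj₁; inj₂)
open import Data.Product using (Σ; _×_)
open import Data.Unit using (⊤)
open import Data.Empty using (⊥)
open import Relation.Binary.PropositionalEquality using (_≡_)

KAdj : (a b : ℕ) → Fin a ⊎ Fin b → Fin a ⊎ Fin b → Set
KAdj a b (inj₁ _) (inj₂ _) = ⊤
KAdj a b (inj₂ _) (inj₁ _) = ⊤
KAdj a b (inj₁ _) (inj₁ _) = ⊥
KAdj a b (inj₂ _) (inj₂ _) = ⊥

-- Visibility in a storyplan with vertex ordering τ : V → [n]
-- (steps are Fin n, i.e. [n] shifted to start at 0):
-- v is visible at step i iff τ(v) ≤ i ≤ max_{u ∈ N[v]} τ(u).
-- The upper bound "i ≤ max over the closed neighbourhood" is written out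
-- as "some u in N[v] (u = v or u adjacent to v) has i ≤ τ(u)".
Visible : {V : Set} {n : ℕ} → (V → V → Set) → (V → Fin n) → V → Fin n → Set
Visible {V} Adj τ v i =
  (toℕ (τ v) ≤ toℕ i) × Σ V (λ u → (u ≡ v ⊎ Adj v u) × (toℕ i ≤ toℕ (τ u)))

{-# OPTIONS --safe #-}
module Submission where

-- Let a* and b* be the vertices of A and B placed last by τ, and suppose
-- τ(a*) ≤ τ(b*). At step τ(a*) every vertex of A has already appeared, and each
-- remains visible since its neighbour b* appears at or after that step; the
-- other case is symmetric.

open import Defs
open import Data.Nat using (ℕ; _+_; _<_; _≤_; zero; suc; _≤?_)
open import Data.Nat.Properties using (≤-refl; ≤-trans; <⇒≤; ≰⇒>)
open import Data.Fin using (Fin; toℕ; zero; suc)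
open import Data.Sum using (_⊎_; inj₁; inj₂)
open import Data.Product using (∃-syntax; _,_)
open import Data.Unit using (tt)
open import Relation.Nullary using (yes; no)
open import Relation.Binary.PropositionalEquality using (_≡_)
open import Function.Definitions using (Bijective)

argmax : (k : ℕ) (f : Fin (suc k) → ℕ) → ∃[ j ] ∀ x → f x ≤ f j
argmax zero    f = zero , λ { zero → ≤-refl }
argmax (suc k) f with argmax k (λ x → f (suc x))
... | j , f≤fj with f zero ≤? f (suc j)
... | yes f0≤fj = suc j , λ { zero → f0≤fj ; (suc x) → f≤fj x }
... | no  f0≰fj = zero  , λ { zero → ≤-refl
                            ; (suc x) → ≤-trans (f≤fj x) (<⇒≤ (≰⇒> f0≰fj)) }

all-visible-at-last-arrival :
  {V I : Set} {n : ℕ} (Adj : V → V → Set) (τ : V → Fin n)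
  (S : I → V) (j : I) → (∀ x → toℕ (τ (S x)) ≤ toℕ (τ (S j))) →
  (w : V) → (∀ x → Adj (S x) w) → toℕ (τ (S j)) ≤ toℕ (τ w) →
  ∀ x → Visible Adj τ (S x) (τ (S j))
all-visible-at-last-arrival Adj τ S j arrived w adj stays x =
  arrived x , w , inj₂ (adj x) , stays

lemma7 : (a b : ℕ) → 0 < a + b →
    (τ : Fin a ⊎ Fin b → Fin (a + b)) → Bijective _≡_ _≡_ τ →
    ∃[ i ] ((∀ x → Visible (KAdj a b) τ (inj₁ x) i)
    ⊎ (∀ y → Visible (KAdj a b) τ (inj₂ y) i))
lemma7 zero    (suc b) _ τ _ = zero , inj₁ (λ ())
lemma7 (suc a) zero    _ τ _ = zero , inj₂ (λ ())
lemma7 (suc a) (suc b) _ τ _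
  with argmax a (λ x → toℕ (τ (inj₁ x))) | argmax b (λ y → toℕ (τ (inj₂ y)))
... | a* , a*-last | b* , b*-last with toℕ (τ (inj₁ a*)) ≤? toℕ (τ (inj₂ b*))
... | yes a*≤b* = τ (inj₁ a*) , inj₁
      (all-visible-at-last-arrival (KAdj _ _) τ inj₁ a* a*-last (inj₂ b*) (λ _ → tt) a*≤b*)
... | no  a*≰b* = τ (inj₂ b*) , inj₂
      (all-visible-at-last-arrival (KAdj _ _) τ inj₂ b* b*-last (inj₁ a*) (λ _ → tt) (<⇒≤ (≰⇒> a*≰b*)))
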